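{- Let $x,y,z,c\in\mathbb{C}$ and let $\alpha=(\alpha_i)_{i\geq0}$, $\beta=(\beta_j)_{j\geq0}$ be the sequences $\alpha_i=cz^i$, $\beta_j=cx^j$ (with $0^0=1$). Then for every $n\geq1$, the determinant of the $n\times n$ principal submatrix of $P_{\alpha,\beta}^{[x,y,z]}$ equals \[ \det P_{\alpha,\beta}^{[x,y,z]}=c^n(y+xz)^{\binom{n}{2}}. \]
   Context: For complex numbers $x,y,z$ and complex sequences $\alpha=(\alpha_i)_{i\geq0}$, $\beta=(\beta_i)_{i\geq0}$ with $\alpha_0=\beta_0$, the weighted recurrence matrix $P_{\alpha,\beta}^{[x,y,z]}=[P_{i,j}]_{i,j\geq0}$ is the infinite matrix defined by $P_{i,0}=\alpha_i$, $P_{0,j}=\beta_j$ for $i,j\geq 0$, and $P_{i,j}=xP_{i,j-1}+yP_{i-1,j-1}+zP_{i-1,j}$ for $i,j\geq1$. The principal $n\times n$ submatrix consists of rows and columns $0,\ldots,n-1$. -}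

module Defs where

open import Level using (Level)
open import Algebra.Bundles using (CommutativeRing)
open import Data.Nat using (ℕ; zero; suc)
open import Data.Fin using (Fin; zero; suc; toℕ; punchIn)

-- Generic definitions over a commutative ring R (the paper works over ℂ).
module _ {a ℓ : Level} (R : CommutativeRing a ℓ) where
  open CommutativeRing R using (Carrier; _+_; _*_; -_; 0#; 1#)

  pow : Carrier → ℕ → Carrier
  pow r zero    = 1#
  pow r (suc k) = r * pow r k

  sumFin : (n : ℕ) → (Fin n → Carrier) → Carrier
  sumFin zero    f = 0#
  sumFin (suc n) f = f zero + sumFin n (λ i → f (suc i))

  sgn : ℕ → Carrier
  sgn zero    = 1#
  sgn (suc k) = - sgn k

  det : (n : ℕ) → (Fin n → Fin n → Carrier) → Carrier
  det zero    M = 1#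
  det (suc n) M =
    sumFin (suc n) (λ j → sgn (toℕ j) * (M zero j * det n (λ r c → M (suc r) (punchIn j c))))

  -- P 0 j = β j, P i 0 = α i (for i ≥ 1; at (0,0) the standing assumption α 0 = β 0 applies),
  -- P i j = x P(i,j-1) + y P(i-1,j-1) + z P(i-1,j) for i,j ≥ 1.
  recMat : (α β : ℕ → Carrier) (x y z : Carrier) → ℕ → ℕ → Carrier
  recMat α β x y z zero    j       = β j
  recMat α β x y z (suc i) zero    = α (suc i)
  recMat α β x y z (suc i) (suc j) =
    x * recMat α β x y z (suc i) j + y * recMat α β x y z i j + z * recMat α β x y z i (suc j)

  principal : (ℕ → ℕ → Carrier) → (n : ℕ) → Fin n → Fin n → Carrier
  principal P n i j = P (toℕ i) (toℕ j)

{-# OPTIONS --safe #-}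
module Submission where

-- Subtract x times each column from the next one, then z times each row from the next one;
-- neither operation changes the determinant. Because the first row of P is c, cx, cx², …,
-- it becomes (c, 0, …, 0), and the recurrence turns every entry (i+1, j+1) into
-- (y + xz) P(i, j). Expanding along the first row gives det P₍ₙ₊₁₎ = c (y + xz)ⁿ det Pₙ,
-- and n + C(n,2) = C(n+1,2) yields the closed form; the first column α never enters.
-- Column operations reduce to one adjacent pair at a time (multilinearity, plus vanishing
-- for two equal adjacent columns), row operations to columns via det Mᵀ = det M.

open import Defs
open import Level using (Level)
open import Algebra.Bundles using (CommutativeRing)
open import Data.Nat as ℕ using (ℕ; zero; suc; z≤n; s≤s; _≤_; _<_; _<?_)
open import Data.Nat.Properties using (≤-refl; <⇒≤; n≤1+n)
open import Data.Nat.Combinatorics using (_C_; nCk+nC[k+1]≡[n+1]C[k+1]; nC1≡n)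
open import Data.Fin using (Fin; zero; suc; toℕ; punchIn; punchOut; _≟_)
open import Data.Fin.Properties
  using (punchIn-injective; punchInᵢ≢i; punchIn-punchOut; toℕ-injective; toℕ<n; suc-injective)
open import Data.Vec.Functional using (Vector; updateAt)
open import Data.Vec.Functional.Properties using (updateAt-updates; updateAt-minimal)
open import Data.Product using (∃₂; _×_; _,_)
open import Data.Sum using (_⊎_; inj₁; inj₂)
open import Function using (const)
open import Relation.Nullary using (yes; no; contradiction)
open import Relation.Binary.PropositionalEquality as ≡ using (_≡_; _≢_)
import Algebra.Solver.Ring.NaturalCoefficients.Default as SemiringSolver
import Algebra.Properties.Ring as RingProperties
import Algebra.Properties.Semiring.Sum as SumProperties
import Algebra.Properties.Semiring.Exp as ExpProperties
import Relation.Binary.Reasoning.Setoid as SetoidReasoning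

private variable
  n : ℕ
  j k l : Fin n

n+nC2≡[1+n]C2 : ∀ n → n ℕ.+ n C 2 ≡ suc n C 2
n+nC2≡[1+n]C2 n = ≡.trans (≡.cong (ℕ._+ n C 2) (≡.sym (nC1≡n n))) (nCk+nC[k+1]≡[n+1]C[k+1] n 1)

data Adjacent : ∀ {n} → Fin n → Fin n → Set where
  zero-one : Adjacent {suc (suc n)} zero (suc zero)
  suc-suc  : Adjacent k l → Adjacent (suc k) (suc l)

adjacent-toℕ : Adjacent k l → toℕ l ≡ suc (toℕ k)
adjacent-toℕ zero-one    = ≡.refl
adjacent-toℕ (suc-suc a) = ≡.cong suc (adjacent-toℕ a)

adjacent-≢ : Adjacent k l → k ≢ l
adjacent-≢ zero-one    ()
adjacent-≢ (suc-suc a) k≡l = adjacent-≢ a (suc-injective k≡l)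

adjacent-at : ∀ m → suc m < n → ∃₂ λ (k l : Fin n) → Adjacent k l × toℕ k ≡ m × toℕ l ≡ suc m
adjacent-at {suc (suc n)} zero    _ = zero , suc zero , zero-one , ≡.refl , ≡.refl
adjacent-at {suc n}       (suc m) (s≤s m<n) with adjacent-at m m<n
... | k , l , a , k≡m , l≡1+m = suc k , suc l , suc-suc a , ≡.cong suc k≡m , ≡.cong suc l≡1+m

adjacent-punchOut : ∀ {j k l : Fin (suc n)} (j≢k : j ≢ k) (j≢l : j ≢ l) →
                    Adjacent k l → Adjacent (punchOut j≢k) (punchOut j≢l)
adjacent-punchOut {j = zero} j≢k _ zero-one = contradiction ≡.refl j≢k
adjacent-punchOut {j = zero} _ _ (suc-suc a) = a
adjacent-punchOut {j = suc zero} _ j≢l zero-one = contradiction ≡.refl j≢l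
adjacent-punchOut {suc (suc n)} {suc (suc j)} _ _ zero-one = zero-one
adjacent-punchOut {suc n} {suc j} j≢k j≢l (suc-suc a) =
  suc-suc (adjacent-punchOut (λ e → j≢k (≡.cong suc e)) (λ e → j≢l (≡.cong suc e)) a)

adjacent-punchIn : Adjacent k l → ∀ c →
                   punchIn k c ≡ punchIn l c ⊎ (punchIn k c ≡ l × punchIn l c ≡ k)
adjacent-punchIn zero-one    zero    = inj₂ (≡.refl , ≡.refl)
adjacent-punchIn zero-one    (suc c) = inj₁ ≡.refl
adjacent-punchIn (suc-suc a) zero    = inj₁ ≡.refl
adjacent-punchIn (suc-suc a) (suc c) with adjacent-punchIn a c
... | inj₁ same         = inj₁ (≡.cong suc same)
... | inj₂ (k↦l , l↦k) = inj₂ (≡.cong suc k↦l , ≡.cong suc l↦k)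

_ᵀ : ∀ {a} {I : Set} {A : Set a} → (I → I → A) → I → I → A
(M ᵀ) i j = M j i

module _ {a ℓ : Level} (R : CommutativeRing a ℓ) where
  open CommutativeRing R hiding (zero)
  open RingProperties ring using (-‿distribˡ-*; -‿distribʳ-*; -‿involutive)
  open SumProperties semiring
    using (sum; sum-cong-≋; sum-replicate-zero; ∑-distrib-+; ∑-comm; *-distribˡ-sum)
  open ExpProperties semiring using (_^_; ^-homo-*)
  open SemiringSolver commutativeSemiring using (solve; _:=_; _:+_; _:*_)
  open SetoidReasoning setoid

  x*y+-x*y≈0 : ∀ x y → x * y + (- x) * y ≈ 0#
  x*y+-x*y≈0 x y = trans (+-congˡ (sym (-‿distribˡ-* x y))) (-‿inverseʳ (x * y))

  -x*-y≈x*y : ∀ x y → (- x) * (- y) ≈ x * y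
  -x*-y≈x*y x y = begin
    (- x) * (- y)  ≈⟨ -‿distribˡ-* x (- y) ⟨
    - (x * - y)    ≈⟨ -‿cong (-‿distribʳ-* x y) ⟨
    - - (x * y)    ≈⟨ -‿involutive (x * y) ⟩
    x * y          ∎

  pow≡^ : ∀ x n → pow R x n ≡ x ^ n
  pow≡^ x zero    = ≡.refl
  pow≡^ x (suc n) = ≡.cong (x *_) (pow≡^ x n)

  pow-homo-* : ∀ x m n → pow R x (m ℕ.+ n) ≈ pow R x m * pow R x n
  pow-homo-* x m n = begin
    pow R x (m ℕ.+ n)      ≡⟨ pow≡^ x (m ℕ.+ n) ⟩
    x ^ (m ℕ.+ n)          ≈⟨ ^-homo-* x m n ⟩
    x ^ m * x ^ n          ≡⟨ ≡.cong₂ _*_ (pow≡^ x m) (pow≡^ x n) ⟨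
    pow R x m * pow R x n  ∎

  sumFin≡sum : ∀ n (f : Vector Carrier n) → sumFin R n f ≡ sum f
  sumFin≡sum zero    f = ≡.refl
  sumFin≡sum (suc n) f = ≡.cong (f zero +_) (sumFin≡sum n (λ i → f (suc i)))

  sum-zero : ∀ {n} {f : Vector Carrier n} → (∀ i → f i ≈ 0#) → sum f ≈ 0#
  sum-zero {n} f≈0 = trans (sum-cong-≋ f≈0) (sum-replicate-zero n)

  sum-adjacent-cancel : ∀ {f : Vector Carrier n} → Adjacent k l →
    (∀ j → j ≢ k → j ≢ l → f j ≈ 0#) → f k + f l ≈ 0# → sum f ≈ 0#
  sum-adjacent-cancel {f = f} zero-one rest≈0 pair≈0 = begin
    f zero + (f (suc zero) + sum (λ i → f (suc (suc i))))
      ≈⟨ +-assoc _ _ _ ⟨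
    (f zero + f (suc zero)) + sum (λ i → f (suc (suc i)))
      ≈⟨ +-cong pair≈0 (sum-zero (λ i → rest≈0 (suc (suc i)) (λ ()) (λ ()))) ⟩
    0# + 0#
      ≈⟨ +-identityʳ 0# ⟩
    0#  ∎
  sum-adjacent-cancel {k = suc k} {l = suc l} {f = f} (suc-suc a) rest≈0 pair≈0 =
    trans (+-cong (rest≈0 zero (λ ()) (λ ())) (sum-adjacent-cancel a tail-rest≈0 pair≈0)) (+-identityʳ 0#)
    where
    tail-rest≈0 : ∀ j → j ≢ k → j ≢ l → f (suc j) ≈ 0#
    tail-rest≈0 j j≢k j≢l = rest≈0 (suc j) (λ e → j≢k (suc-injective e)) (λ e → j≢l (suc-injective e))

  Matrix : ℕ → Set a
  Matrix n = Fin n → Fin n → Carrier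

  minor : Matrix (suc n) → Fin (suc n) → Matrix n
  minor M j r c = M (suc r) (punchIn j c)

  laplaceTerm : Matrix (suc n) → Fin (suc n) → Carrier
  laplaceTerm {n} M j = sgn R (toℕ j) * (M zero j * det R n (minor M j))

  det-laplace : (M : Matrix (suc n)) → det R (suc n) M ≡ sum (laplaceTerm M)
  det-laplace M = sumFin≡sum _ (laplaceTerm M)

  det-cong : {M N : Matrix n} → (∀ i j → M i j ≈ N i j) → det R n M ≈ det R n N
  det-cong {zero}  _   = refl
  det-cong {suc n} {M} {N} M≈N = begin
    det R (suc n) M      ≡⟨ det-laplace M ⟩
    sum (laplaceTerm M)  ≈⟨ sum-cong-≋ {x = laplaceTerm M} terms ⟩
    sum (laplaceTerm N)  ≡⟨ det-laplace N ⟨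
    det R (suc n) N      ∎
    where
    terms : ∀ j → laplaceTerm M j ≈ laplaceTerm N j
    terms j = *-congˡ (*-cong (M≈N zero j) (det-cong (λ r c → M≈N (suc r) (punchIn j c))))

  AgreeOff : Fin n → Matrix n → Matrix n → Set ℓ
  AgreeOff q M N = ∀ i j → j ≢ q → M i j ≈ N i j

  agreeOff-minor : ∀ {q : Fin (suc n)} {M N} (j≢q : j ≢ q) → AgreeOff q M N →
                   AgreeOff (punchOut j≢q) (minor M j) (minor N j)
  agreeOff-minor {j = j} j≢q M≈N r c c≢q′ = M≈N (suc r) (punchIn j c) (λ e → c≢q′ (punchIn-injective j c _
    (≡.trans e (≡.sym (punchIn-punchOut j≢q)))))

  agreeOff⇒minor≈ : ∀ {q : Fin (suc n)} {M N} → AgreeOff q M N →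
                    ∀ r c → minor M q r c ≈ minor N q r c
  agreeOff⇒minor≈ {q = q} M≈N r c = M≈N (suc r) (punchIn q c) (punchInᵢ≢i q c)

  det-linear-column : ∀ {L M K : Matrix n} (q : Fin n) (b : Carrier) →
    AgreeOff q L M → AgreeOff q K M → (∀ i → L i q ≈ M i q + b * K i q) →
    det R n L ≈ det R n M + b * det R n K
  det-linear-column {suc n} {L} {M} {K} q b L≈M K≈M L-col = begin
    det R (suc n) L
      ≡⟨ det-laplace L ⟩
    sum (laplaceTerm L)
      ≈⟨ sum-cong-≋ {x = laplaceTerm L} term ⟩
    sum (λ j → laplaceTerm M j + b * laplaceTerm K j)
      ≈⟨ ∑-distrib-+ (laplaceTerm M) (λ j → b * laplaceTerm K j) ⟩
    sum (laplaceTerm M) + sum (λ j → b * laplaceTerm K j)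
      ≈⟨ +-congˡ (*-distribˡ-sum b (laplaceTerm K)) ⟨
    sum (laplaceTerm M) + b * sum (laplaceTerm K)
      ≡⟨ ≡.cong₂ (λ u v → u + b * v) (det-laplace M) (det-laplace K) ⟨
    det R (suc n) M + b * det R (suc n) K  ∎
    where
    distribʳ-scaled : ∀ s m k d → s * ((m + b * k) * d) ≈ s * (m * d) + b * (s * (k * d))
    distribʳ-scaled s m k d =
      solve 5 (λ b s m k d → s :* ((m :+ b :* k) :* d) := s :* (m :* d) :+ b :* (s :* (k :* d))) refl b s m k d
    distribˡ-scaled : ∀ s m d e → s * (m * (d + b * e)) ≈ s * (m * d) + b * (s * (m * e))
    distribˡ-scaled s m d e =
      solve 5 (λ b s m d e → s :* (m :* (d :+ b :* e)) := s :* (m :* d) :+ b :* (s :* (m :* e))) refl b s m d e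
    term : ∀ j → laplaceTerm L j ≈ laplaceTerm M j + b * laplaceTerm K j
    term j with j ≟ q
    ... | yes ≡.refl = begin
      s * (L zero j * det R n (minor L j))
        ≈⟨ *-congˡ (*-cong (L-col zero) (det-cong (agreeOff⇒minor≈ L≈M))) ⟩
      s * ((M zero j + b * K zero j) * dM)
        ≈⟨ distribʳ-scaled s _ _ dM ⟩
      s * (M zero j * dM) + b * (s * (K zero j * dM))
        ≈⟨ +-congˡ (*-congˡ (*-congˡ (*-congˡ (det-cong (agreeOff⇒minor≈ K≈M))))) ⟨
      laplaceTerm M j + b * laplaceTerm K j  ∎
      where
      s = sgn R (toℕ j)
      dM = det R n (minor M j)
    ... | no j≢q = begin
      s * (L zero j * det R n (minor L j))
        ≈⟨ *-congˡ (*-cong (L≈M zero j j≢q) minors) ⟩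
      s * (M zero j * (dM + b * dK))
        ≈⟨ distribˡ-scaled s _ dM dK ⟩
      s * (M zero j * dM) + b * (s * (M zero j * dK))
        ≈⟨ +-congˡ (*-congˡ (*-congˡ (*-congʳ (K≈M zero j j≢q)))) ⟨
      laplaceTerm M j + b * laplaceTerm K j  ∎
      where
      s = sgn R (toℕ j)
      dM = det R n (minor M j)
      dK = det R n (minor K j)
      minors : det R n (minor L j) ≈ dM + b * dK
      minors = det-linear-column (punchOut j≢q) b (agreeOff-minor j≢q L≈M) (agreeOff-minor j≢q K≈M) minor-col
        where
        minor-col : ∀ r → let c = punchOut j≢q in minor L j r c ≈ minor M j r c + b * minor K j r c
        minor-col r rewrite punchIn-punchOut j≢q = L-col (suc r)

  det-equal-adjacent-columns : ∀ {M : Matrix n} → Adjacent k l →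
                               (∀ i → M i k ≈ M i l) → det R n M ≈ 0#
  det-equal-adjacent-columns {suc n} {k} {l} {M} a cols = begin
    det R (suc n) M      ≡⟨ det-laplace M ⟩
    sum (laplaceTerm M)  ≈⟨ sum-adjacent-cancel a other pair ⟩
    0#                   ∎
    where
    other : ∀ j → j ≢ k → j ≢ l → laplaceTerm M j ≈ 0#
    other j j≢k j≢l = begin
      sgn R (toℕ j) * (M zero j * det R n (minor M j))
        ≈⟨ *-congˡ (*-congˡ (det-equal-adjacent-columns (adjacent-punchOut j≢k j≢l a) minor-cols)) ⟩
      sgn R (toℕ j) * (M zero j * 0#)
        ≈⟨ trans (*-congˡ (zeroʳ _)) (zeroʳ _) ⟩
      0#  ∎
      where
      minor-cols : ∀ r → minor M j r (punchOut j≢k) ≈ minor M j r (punchOut j≢l)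
      minor-cols r rewrite punchIn-punchOut j≢k | punchIn-punchOut j≢l = cols (suc r)
    minors : ∀ r c → minor M k r c ≈ minor M l r c
    minors r c with adjacent-punchIn a c
    ... | inj₁ same = reflexive (≡.cong (M (suc r)) same)
    ... | inj₂ (k↦l , l↦k) rewrite k↦l | l↦k = sym (cols (suc r))
    pair : laplaceTerm M k + laplaceTerm M l ≈ 0#
    pair = begin
      s * (M zero k * d) + sgn R (toℕ l) * (M zero l * det R n (minor M l))
        ≈⟨ +-congˡ (*-cong (reflexive (≡.cong (sgn R) (adjacent-toℕ a)))
                           (*-cong (sym (cols zero)) (sym (det-cong minors)))) ⟩
      s * (M zero k * d) + (- s) * (M zero k * d)
        ≈⟨ x*y+-x*y≈0 s _ ⟩
      0#  ∎
      where
      s = sgn R (toℕ k)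
      d = det R n (minor M k)

  det-add-adjacent-column : ∀ {M′ M : Matrix n} → Adjacent k l → (b : Carrier) →
    AgreeOff l M′ M → (∀ i → M′ i l ≈ M i l + b * M i k) → det R n M′ ≈ det R n M
  det-add-adjacent-column {n} {k} {l} {M′} {M} a b M′≈M M′-col = begin
    det R n M′                 ≈⟨ det-linear-column l b M′≈M K≈M M′-col′ ⟩
    det R n M + b * det R n K  ≈⟨ +-congˡ (*-congˡ (det-equal-adjacent-columns a K-cols)) ⟩
    det R n M + b * 0#         ≈⟨ trans (+-congˡ (zeroʳ b)) (+-identityʳ _) ⟩
    det R n M                  ∎
    where
    K : Matrix n
    K i = updateAt (M i) l (const (M i k))
    K-off : ∀ i j → j ≢ l → K i j ≡ M i j
    K-off i j j≢l = updateAt-minimal j l (M i) j≢l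
    K≈M : AgreeOff l K M
    K≈M i j j≢l = reflexive (K-off i j j≢l)
    K-col : ∀ i → K i l ≡ M i k
    K-col i = updateAt-updates l (M i)
    K-cols : ∀ i → K i k ≈ K i l
    K-cols i = reflexive (≡.trans (K-off i k (adjacent-≢ a)) (≡.sym (K-col i)))
    M′-col′ : ∀ i → M′ i l ≈ M i l + b * K i l
    M′-col′ i = trans (M′-col i) (+-congˡ (*-congˡ (reflexive (≡.sym (K-col i)))))

  *-distribˡ-sum₂ : ∀ {n} u v (f : Vector Carrier n) → u * (v * sum f) ≈ sum (λ i → u * (v * f i))
  *-distribˡ-sum₂ u v f = trans (*-congˡ (*-distribˡ-sum v f)) (*-distribˡ-sum u (λ i → v * f i))

  columnTerm : Matrix (suc n) → Fin (suc n) → Carrier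
  columnTerm {n} M i = sgn R (toℕ i) * (M i zero * det R n (minor (M ᵀ) i ᵀ))

  -- Both sides share the (0,0) term; expanding the remaining minors once more turns both
  -- into the same double sum over D i j (rows 0, i+1 and columns 0, j+1 deleted), summed
  -- in the two orders.
  det-column-expansion : (M : Matrix (suc n)) → det R (suc n) M ≈ sum (columnTerm M)
  det-column-expansion {zero}  M = refl
  det-column-expansion {suc n} M = begin
    det R (suc (suc n)) M             ≡⟨ det-laplace M ⟩
    laplaceTerm M zero + sum rowTerm  ≈⟨ +-congˡ rows≈columns ⟩
    columnTerm M zero + sum colTerm   ∎
    where
    s : ∀ {m} → Fin m → Carrier
    s i = sgn R (toℕ i)
    D : Fin (suc n) → Fin (suc n) → Carrier
    D i j = det R n (λ r c → M (suc (punchIn i r)) (suc (punchIn j c)))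
    rowTerm colTerm : Fin (suc n) → Carrier
    rowTerm j = - s j * (M zero (suc j) * det R (suc n) (minor M (suc j)))
    colTerm i = - s i * (M (suc i) zero * det R (suc n) (minor (M ᵀ) (suc i) ᵀ))
    T : Fin (suc n) → Fin (suc n) → Carrier
    T j i = - s j * (M zero (suc j) * (s i * (M (suc i) zero * D i j)))
    expand-row : ∀ j → rowTerm j ≈ sum (T j)
    expand-row j = trans (*-congˡ (*-congˡ (det-column-expansion (minor M (suc j)))))
                         (*-distribˡ-sum₂ (- s j) (M zero (suc j)) (λ i → s i * (M (suc i) zero * D i j)))
    swap : ∀ x y p q d → - x * (p * (y * (q * d))) ≈ - y * (q * (x * (p * d)))
    swap x y p q d = begin
      - x * (p * (y * (q * d)))    ≈⟨ -‿distribˡ-* x _ ⟨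
      - (x * (p * (y * (q * d))))  ≈⟨ -‿cong (reorder x y p q d) ⟩
      - (y * (q * (x * (p * d))))  ≈⟨ -‿distribˡ-* y _ ⟩
      - y * (q * (x * (p * d)))    ∎
      where
      reorder : ∀ x y p q d → x * (p * (y * (q * d))) ≈ y * (q * (x * (p * d)))
      reorder = solve 5 (λ x y p q d → x :* (p :* (y :* (q :* d))) := y :* (q :* (x :* (p :* d)))) refl
    collect-column : ∀ i → sum (λ j → T j i) ≈ colTerm i
    collect-column i = begin
      sum (λ j → T j i)
        ≈⟨ sum-cong-≋ {x = λ j → T j i} (λ j → swap (s j) (s i) (M zero (suc j)) (M (suc i) zero) (D i j)) ⟩
      sum (λ j → - s i * (M (suc i) zero * (s j * (M zero (suc j) * D i j))))
        ≈⟨ *-distribˡ-sum₂ (- s i) (M (suc i) zero) (λ j → s j * (M zero (suc j) * D i j)) ⟨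
      - s i * (M (suc i) zero * sum (λ j → s j * (M zero (suc j) * D i j)))
        ≡⟨ ≡.cong (λ d → - s i * (M (suc i) zero * d)) (det-laplace (minor (M ᵀ) (suc i) ᵀ)) ⟨
      colTerm i ∎
    rows≈columns : sum rowTerm ≈ sum colTerm
    rows≈columns = begin
      sum rowTerm                    ≈⟨ sum-cong-≋ {x = rowTerm} expand-row ⟩
      sum (λ j → sum (T j))          ≈⟨ ∑-comm T ⟩
      sum (λ i → sum (λ j → T j i))  ≈⟨ sum-cong-≋ {y = colTerm} collect-column ⟩
      sum colTerm                    ∎

  det-transpose : (M : Matrix n) → det R n (M ᵀ) ≈ det R n M
  det-transpose {zero}  M = refl
  det-transpose {suc n} M = begin
    det R (suc n) (M ᵀ)      ≡⟨ det-laplace (M ᵀ) ⟩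
    sum (laplaceTerm (M ᵀ))  ≈⟨ sum-cong-≋ {y = columnTerm M} terms ⟩
    sum (columnTerm M)       ≈⟨ det-column-expansion M ⟨
    det R (suc n) M          ∎
    where
    terms : ∀ i → laplaceTerm (M ᵀ) i ≈ columnTerm M i
    terms i = *-congˡ (*-congˡ (sym (det-transpose (minor (M ᵀ) i))))

  det-scale : ∀ w (M : Matrix n) → det R n (λ i j → w * M i j) ≈ pow R w n * det R n M
  det-scale {zero}  w M = sym (*-identityʳ 1#)
  det-scale {suc n} w M = begin
    det R (suc n) wM                                 ≡⟨ det-laplace wM ⟩
    sum (laplaceTerm wM)                             ≈⟨ sum-cong-≋ {x = laplaceTerm wM} term ⟩
    sum (λ j → (w * pow R w n) * laplaceTerm M j)    ≈⟨ *-distribˡ-sum (w * pow R w n) (laplaceTerm M) ⟨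
    (w * pow R w n) * sum (laplaceTerm M)            ≡⟨ ≡.cong (w * pow R w n *_) (det-laplace M) ⟨
    pow R w (suc n) * det R (suc n) M                ∎
    where
    wM : Matrix (suc n)
    wM i j = w * M i j
    term : ∀ j → laplaceTerm wM j ≈ (w * pow R w n) * laplaceTerm M j
    term j = trans (*-congˡ (*-congˡ (det-scale w (minor M j))))
                   (regroup (sgn R (toℕ j)) (M zero j) (pow R w n) (det R n (minor M j)))
      where
      regroup : ∀ s m p d → s * ((w * m) * (p * d)) ≈ (w * p) * (s * (m * d))
      regroup s m p d = solve 5 (λ s w m p d → s :* ((w :* m) :* (p :* d)) := (w :* p) :* (s :* (m :* d))) refl s w m p d

  det-firstRow-single-entry : (M : Matrix (suc n)) → (∀ j → M zero (suc j) ≈ 0#) →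
                              det R (suc n) M ≈ M zero zero * det R n (minor M zero)
  det-firstRow-single-entry M row≈0 = begin
    det R _ M
      ≡⟨ det-laplace M ⟩
    1# * (M zero zero * det R _ (minor M zero)) + sum (λ j → laplaceTerm M (suc j))
      ≈⟨ +-cong (*-identityˡ _) (sum-zero tail≈0) ⟩
    M zero zero * det R _ (minor M zero) + 0#
      ≈⟨ +-identityʳ _ ⟩
    M zero zero * det R _ (minor M zero)  ∎
    where
    tail≈0 : ∀ j → laplaceTerm M (suc j) ≈ 0#
    tail≈0 j = trans (*-congˡ (trans (*-congʳ (row≈0 j)) (zeroˡ _))) (zeroʳ _)

  Matrix∞ : Set a
  Matrix∞ = ℕ → ℕ → Carrier

  det-principal-add-column : ∀ n m b {K′ K : Matrix∞} →
    (∀ i j → j ≢ suc m → K′ i j ≈ K i j) → (∀ i → K′ i (suc m) ≈ K i (suc m) + b * K i m) →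
    det R n (principal R K′ n) ≈ det R n (principal R K n)
  det-principal-add-column n m b {K′} {K} K′≈K K′-col with suc m <? n
  ... | yes 1+m<n with adjacent-at m 1+m<n
  ...   | k , l , a , k≡m , l≡1+m = det-add-adjacent-column a b off col
    where
    off : AgreeOff l (principal R K′ n) (principal R K n)
    off i j j≢l = K′≈K (toℕ i) (toℕ j) (λ e → j≢l (toℕ-injective (≡.trans e (≡.sym l≡1+m))))
    col : ∀ (i : Fin n) → K′ (toℕ i) (toℕ l) ≈ K (toℕ i) (toℕ l) + b * K (toℕ i) (toℕ k)
    col i rewrite k≡m | l≡1+m = K′-col (toℕ i)
  det-principal-add-column n m b K′≈K K′-col | no 1+m≮n =
    det-cong (λ i j → K′≈K (toℕ i) (toℕ j) (λ e → 1+m≮n (≡.subst (_< n) e (toℕ<n j))))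

  shiftColumns : Carrier → Matrix∞ → Matrix∞
  shiftColumns b K i zero    = K i zero
  shiftColumns b K i (suc j) = K i (suc j) + b * K i j

  -- Only the columns j+1 with j ≥ m are shifted, so raising m by one undoes exactly one
  -- adjacent-column operation, and for m ≥ n the principal n×n part is untouched.
  shiftColumnsAfter : Carrier → ℕ → Matrix∞ → Matrix∞
  shiftColumnsAfter b zero    K           = shiftColumns b K
  shiftColumnsAfter b (suc m) K i zero    = K i zero
  shiftColumnsAfter b (suc m) K i (suc j) = shiftColumnsAfter b m (λ i j → K i (suc j)) i j

  shiftColumnsAfter-≤ : ∀ b m K i {j} → j ≤ m → shiftColumnsAfter b m K i j ≡ K i j
  shiftColumnsAfter-≤ b zero    K i z≤n       = ≡.refl
  shiftColumnsAfter-≤ b (suc m) K i z≤n       = ≡.refl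
  shiftColumnsAfter-≤ b (suc m) K i (s≤s j≤m) = shiftColumnsAfter-≤ b m (λ i j → K i (suc j)) i j≤m

  shiftColumnsAfter-suc : ∀ b m K i → shiftColumnsAfter b m K i (suc m) ≡ K i (suc m) + b * K i m
  shiftColumnsAfter-suc b zero    K i = ≡.refl
  shiftColumnsAfter-suc b (suc m) K i = shiftColumnsAfter-suc b m (λ i j → K i (suc j)) i

  shiftColumnsAfter-≢ : ∀ b m K i j → j ≢ suc m →
                        shiftColumnsAfter b m K i j ≡ shiftColumnsAfter b (suc m) K i j
  shiftColumnsAfter-≢ b zero    K i zero          _      = ≡.refl
  shiftColumnsAfter-≢ b zero    K i (suc zero)    j≢1    = contradiction ≡.refl j≢1
  shiftColumnsAfter-≢ b zero    K i (suc (suc j)) _      = ≡.refl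
  shiftColumnsAfter-≢ b (suc m) K i zero          _      = ≡.refl
  shiftColumnsAfter-≢ b (suc m) K i (suc j)       j≢2+m  =
    shiftColumnsAfter-≢ b m (λ i j → K i (suc j)) i j (λ e → j≢2+m (≡.cong suc e))

  det-principal-shiftColumns : ∀ n b K →
    det R n (principal R (shiftColumns b K) n) ≈ det R n (principal R K n)
  det-principal-shiftColumns n b K =
    trans (shifted n) (det-cong (λ i j → reflexive (shiftColumnsAfter-≤ b n K (toℕ i) (<⇒≤ (toℕ<n j)))))
    where
    S : ℕ → Matrix∞
    S m = shiftColumnsAfter b m K
    S-suc : ∀ m i → S m i (suc m) ≡ S (suc m) i (suc m) + b * S (suc m) i m
    S-suc m i = ≡.trans (shiftColumnsAfter-suc b m K i)
      (≡.sym (≡.cong₂ (λ u v → u + b * v) (shiftColumnsAfter-≤ b (suc m) K i ≤-refl)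
                                          (shiftColumnsAfter-≤ b (suc m) K i (n≤1+n m))))
    shifted : ∀ m → det R n (principal R (S 0) n) ≈ det R n (principal R (S m) n)
    shifted zero    = refl
    shifted (suc m) = trans (shifted m) (det-principal-add-column n m b
      (λ i j j≢1+m → reflexive (shiftColumnsAfter-≢ b m K i j j≢1+m)) (λ i → reflexive (S-suc m i)))

  shiftRows : Carrier → Matrix∞ → Matrix∞
  shiftRows b K = shiftColumns b (K ᵀ) ᵀ

  det-principal-shiftRows : ∀ n b K →
    det R n (principal R (shiftRows b K) n) ≈ det R n (principal R K n)
  det-principal-shiftRows n b K = begin
    det R n (principal R (shiftColumns b (K ᵀ)) n ᵀ)  ≈⟨ det-transpose {n} _ ⟩
    det R n (principal R (shiftColumns b (K ᵀ)) n)    ≈⟨ det-principal-shiftColumns n b (K ᵀ) ⟩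
    det R n (principal R K n ᵀ)                       ≈⟨ det-transpose {n} _ ⟩
    det R n (principal R K n)                         ∎

  elimination : ∀ x y z p q r →
    ((x * p + y * q + z * r) + (- x) * p) + (- z) * (r + (- x) * q) ≈ (y + x * z) * q
  elimination x y z p q r = begin
    ((x * p + y * q + z * r) + (- x) * p) + (- z) * (r + (- x) * q)
      ≈⟨ solve 8 (λ x y z x′ z′ p q r → ((x :* p :+ y :* q :+ z :* r) :+ x′ :* p) :+ z′ :* (r :+ x′ :* q)
                                       := (x :* p :+ x′ :* p) :+ ((z :* r :+ z′ :* r) :+ (y :+ z′ :* x′) :* q))
                 refl x y z (- x) (- z) p q r ⟩
    (x * p + (- x) * p) + ((z * r + (- z) * r) + (y + (- z) * (- x)) * q)
      ≈⟨ +-cong (x*y+-x*y≈0 x p)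
                (+-cong (x*y+-x*y≈0 z r) (*-congʳ (+-congˡ (trans (-x*-y≈x*y z x) (*-comm z x))))) ⟩
    0# + (0# + (y + x * z) * q)
      ≈⟨ trans (+-identityˡ _) (+-identityˡ _) ⟩
    (y + x * z) * q ∎

  det-principal-step : ∀ x y z (K : Matrix∞) →
    (∀ i j → K (suc i) (suc j) ≈ x * K (suc i) j + y * K i j + z * K i (suc j)) →
    (∀ j → K zero (suc j) ≈ x * K zero j) →
    ∀ n → det R (suc n) (principal R K (suc n))
          ≈ K zero zero * (pow R (y + x * z) n * det R n (principal R K n))
  det-principal-step x y z K recurrence firstRow n = begin
    det R (suc n) (principal R K (suc n))
      ≈⟨ det-principal-shiftColumns (suc n) (- x) K ⟨
    det R (suc n) (principal R B (suc n))
      ≈⟨ det-principal-shiftRows (suc n) (- z) B ⟨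
    det R (suc n) (principal R E (suc n))
      ≈⟨ det-firstRow-single-entry (principal R E (suc n)) (λ j → E-firstRow (toℕ j)) ⟩
    K zero zero * det R n (λ i j → E (suc (toℕ i)) (suc (toℕ j)))
      ≈⟨ *-congˡ (det-cong {n} (λ i j → E-inner (toℕ i) (toℕ j))) ⟩
    K zero zero * det R n (λ i j → (y + x * z) * principal R K n i j)
      ≈⟨ *-congˡ (det-scale (y + x * z) (principal R K n)) ⟩
    K zero zero * (pow R (y + x * z) n * det R n (principal R K n))  ∎
    where
    B E : Matrix∞
    B = shiftColumns (- x) K
    E = shiftRows (- z) B
    E-firstRow : ∀ j → E zero (suc j) ≈ 0#
    E-firstRow j = trans (+-congʳ (firstRow j)) (x*y+-x*y≈0 x (K zero j))
    E-inner : ∀ i j → E (suc i) (suc j) ≈ (y + x * z) * K i j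
    E-inner i j = trans (+-congʳ (+-congʳ (recurrence i j)))
                        (elimination x y z (K (suc i) j) (K i j) (K i (suc j)))

  productRecurrence⇒closedForm : ∀ c w (d : ℕ → Carrier) → d zero ≈ 1# →
    (∀ n → d (suc n) ≈ c * (pow R w n * d n)) → ∀ n → d n ≈ pow R c n * pow R w (n C 2)
  productRecurrence⇒closedForm c w d d₀ d-suc zero    = trans d₀ (sym (*-identityʳ 1#))
  productRecurrence⇒closedForm c w d d₀ d-suc (suc n) = begin
    d (suc n)
      ≈⟨ d-suc n ⟩
    c * (pow R w n * d n)
      ≈⟨ *-congˡ (*-congˡ (productRecurrence⇒closedForm c w d d₀ d-suc n)) ⟩
    c * (pow R w n * (pow R c n * pow R w (n C 2)))
      ≈⟨ regroup c (pow R w n) (pow R c n) (pow R w (n C 2)) ⟩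
    pow R c (suc n) * (pow R w n * pow R w (n C 2))
      ≈⟨ *-congˡ (pow-homo-* w n (n C 2)) ⟨
    pow R c (suc n) * pow R w (n ℕ.+ n C 2)
      ≡⟨ ≡.cong (λ e → pow R c (suc n) * pow R w e) (n+nC2≡[1+n]C2 n) ⟩
    pow R c (suc n) * pow R w (suc n C 2)  ∎
    where
    regroup : ∀ c p q r → c * (p * (q * r)) ≈ (c * q) * (p * r)
    regroup = solve 4 (λ c p q r → c :* (p :* (q :* r)) := (c :* q) :* (p :* r)) refl

  det-recMat-geometricFirstRow : ∀ (α : ℕ → Carrier) x y z c n →
    det R n (principal R (recMat R α (λ j → c * pow R x j) x y z) n)
      ≈ pow R c n * pow R (y + x * z) (n C 2)
  det-recMat-geometricFirstRow α x y z c =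
    productRecurrence⇒closedForm c (y + x * z) (λ n → det R n (principal R P n)) refl step
    where
    P : Matrix∞
    P = recMat R α (λ j → c * pow R x j) x y z
    step : ∀ n → det R (suc n) (principal R P (suc n))
                 ≈ c * (pow R (y + x * z) n * det R n (principal R P n))
    step n = trans (det-principal-step x y z P (λ i j → refl) firstRow n) (*-congʳ (*-identityʳ c))
      where
      firstRow : ∀ j → c * (x * pow R x j) ≈ x * (c * pow R x j)
      firstRow j = solve 3 (λ c x p → c :* (x :* p) := x :* (c :* p)) refl c x (pow R x j)

open CommutativeRing using (Carrier; _+_; _*_; _≈_)

corollary2 : {a ℓ : Level} (R : CommutativeRing a ℓ) →
    (x y z c : Carrier R) (n : ℕ) → 1 ≤ n →
    _≈_ R (det R n (principal R (recMat R (λ i → _*_ R c (pow R z i)) (λ j → _*_ R c (pow R x j)) x y z) n))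
          (_*_ R (pow R c n) (pow R (_+_ R y (_*_ R x z)) (n C 2)))
corollary2 R x y z c n _ = det-recMat-geometricFirstRow R (λ i → _*_ R c (pow R z i)) x y z c n
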